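{- Assume the standing assumption on $f$ from the context, and fix $\alpha\in\{a,\bar a\}$ such that: - $L^f_\alpha$ holds and $R^f_\alpha$ does not; - $R^f_{\bar\alpha}$ holds and $L^f_{\bar\alpha}$ does not; - $S^f_{\alpha,\bar\alpha}$ holds. For $n\ge0$ let $p_n=\sum_{i=0}^n\bar\alpha.\alpha^{\le i}$. Let $t\approx u$ be an equation between CCS$_f^-$ terms that is sound modulo bisimilarity, let $\sigma$ be a closed substitution, and put $p=\sigma(t)$, $q=\sigma(u)$. Suppose that $p$ and $q$ have neither $\mathbf 0$ summands nor $\mathbf 0$ factors, and that $p\,\underline{\leftrightarrow}\,f(\alpha,p_n)$ and $q\,\underline{\leftrightarrow}\,f(\alpha,p_n)$ for some $n$ larger than the size of $t$. If $p$ has a summand bisimilar to $f(\alpha,p_n)$, then so does $q$.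
   Context: Actions: $\mathcal A=\{a,\bar a,\tau\}$ with $a\ne\bar a$, $\bar{\bar a}=a$. CCS$_f^-$ terms: $t::=\mathbf 0\mid x\mid \mu.t\mid t+t\mid f(t,t)$. Semantics on closed terms: - $\mu.x\xrightarrow{\mu}x$; - standard choice; - standard CCS parallel composition $\parallel$ (interleaving, plus $\tau$-synchronisation of $\beta,\bar\beta$), which occurs in targets; - the rules for $f$. Standing assumption on $f$: every rule of $f$ has one of the following forms: (S$_{\beta}$) $\dfrac{x_1\xrightarrow{\beta}y_1\ \ x_2\xrightarrow{\bar\beta}y_2}{f(x_1,x_2)\xrightarrow{\tau}y_1\parallel y_2}$ with $\beta\in\{a,\bar a\}$; (L$_\mu$) $\dfrac{x_1\xrightarrow{\mu}y_1}{f(x_1,x_2)\xrightarrow{\mu}y_1\parallel x_2}$; (R$_\mu$) $\dfrac{x_2\xrightarrow{\mu}y_2}{f(x_1,x_2)\xrightarrow{\mu}x_1\parallel y_2}$. Moreover, $f$ has at least one S rule, and for each $\mu$ at least one of L$_\mu$, R$_\mu$. $L^f_\mu$, $R^f_\mu$, $S^f_{\beta,\bar\beta}$ hold iff $f$ has the respective rule. $\underline{\leftrightarrow}$ is strong bisimilarity; $t\approx u$ is sound if $\sigma(t)\,\underline{\leftrightarrow}\,\sigma(u)$ for all closed $\sigma$. A term has a $\mathbf 0$ factor if it contains a subterm $f(t',t'')$ with $t'$ or $t''$ bisimilar to $\mathbf 0$, and a $\mathbf 0$ summand if it contains a subterm $t'+t''$ with $t'$ or $t''$ bisimilar to $\mathbf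 0$. Terms are modulo associativity and commutativity of $+$; the summands of $t_1+\dots+t_k$, with no $t_i$ headed by $+$, are the $t_i$. Size is the number of operator symbols. Notation: $\mu^0=\mathbf 0$, $\mu^{m+1}=\mu.\mu^m$, $\mu^{\le i}=\mu+\dots+\mu^i$ (with $\mu^{\le 0}=\mathbf 0$); $\alpha$ abbreviates $\alpha.\mathbf 0$. -}

module Defs where

open import Data.Bool using (Bool; true; false)
open import Data.Nat using (ℕ; zero; suc; _+_)
open import Data.Empty using (⊥)
open import Data.List using (List; []; _∷_; _++_)
open import Data.Product using (Σ; ∃; _×_; _,_)
open import Data.Sum using (_⊎_)
open import Relation.Binary.PropositionalEquality using (_≡_)

data Name : Set where
  a  : Name
  ā  : Name

bar : Name → Name
bar a = ā
bar ā = a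

data Act : Set where
  nm : Name → Act
  τ  : Act

data Tm (V : Set) : Set where
  𝟎    : Tm V
  var  : V → Tm V
  _·_  : Act → Tm V → Tm V
  _⊕_  : Tm V → Tm V → Tm V
  F    : Tm V → Tm V → Tm V

infixr 6 _·_
infixl 5 _⊕_

CTm : Set
CTm = Tm ⊥

sub : {V : Set} → (V → CTm) → Tm V → CTm
sub σ 𝟎 = 𝟎
sub σ (var x) = σ x
sub σ (μ · t) = μ · sub σ t
sub σ (t ⊕ u) = sub σ t ⊕ sub σ u
sub σ (F t u) = F (sub σ t) (sub σ u)

size : {V : Set} → Tm V → ℕ
size 𝟎 = 1
size (var x) = 0
size (μ · t) = suc (size t)
size (t ⊕ u) = suc (size t + size u)
size (F t u) = suc (size t + size u)

data _⊑_ {V : Set} : Tm V → Tm V → Set where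
  here  : ∀ {s} → s ⊑ s
  inPre : ∀ {s μ t} → s ⊑ t → s ⊑ (μ · t)
  inPlL : ∀ {s t u} → s ⊑ t → s ⊑ (t ⊕ u)
  inPlR : ∀ {s t u} → s ⊑ u → s ⊑ (t ⊕ u)
  inFL  : ∀ {s t u} → s ⊑ t → s ⊑ F t u
  inFR  : ∀ {s t u} → s ⊑ u → s ⊑ F t u

summands : {V : Set} → Tm V → List (Tm V)
summands (t ⊕ u) = summands t ++ summands u
summands t = t ∷ []

data Proc : Set where
  𝟎    : Proc
  _·_  : Act → Proc → Proc
  _⊕_  : Proc → Proc → Proc
  _∥_  : Proc → Proc → Proc
  F    : Proc → Proc → Proc

emb : CTm → Proc
emb 𝟎 = 𝟎
emb (var ())
emb (μ · t) = μ · emb t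
emb (t ⊕ u) = emb t ⊕ emb u
emb (F t u) = F (emb t) (emb u)

record FSpec : Set where
  field
    L : Act → Bool
    R : Act → Bool
    S : Name → Bool  -- S_β : x1 -β-> y1, x2 -β̄-> y2

open FSpec public

-- standing assumption (the rule *forms* are built into the LTS below)
record Standing (f : FSpec) : Set where
  field
    someS   : ∃ λ β → S f β ≡ true
    LorR    : ∀ μ → L f μ ≡ true ⊎ R f μ ≡ true

data Step (f : FSpec) : Proc → Act → Proc → Set where
  pre   : ∀ {μ p} → Step f (μ · p) μ p
  sumL  : ∀ {p q μ p'} → Step f p μ p' → Step f (p ⊕ q) μ p'
  sumR  : ∀ {p q μ q'} → Step f q μ q' → Step f (p ⊕ q) μ q'
  parL  : ∀ {p q μ p'} → Step f p μ p' → Step f (p ∥ q) μ (p' ∥ q)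
  parR  : ∀ {p q μ q'} → Step f q μ q' → Step f (p ∥ q) μ (p ∥ q')
  parS  : ∀ {p q β p' q'} → Step f p (nm β) p' → Step f q (nm (bar β)) q' →
          Step f (p ∥ q) τ (p' ∥ q')
  fS    : ∀ {p q β p' q'} → S f β ≡ true →
          Step f p (nm β) p' → Step f q (nm (bar β)) q' →
          Step f (F p q) τ (p' ∥ q')
  fL    : ∀ {p q μ p'} → L f μ ≡ true → Step f p μ p' → Step f (F p q) μ (p' ∥ q)
  fR    : ∀ {p q μ q'} → R f μ ≡ true → Step f q μ q' → Step f (F p q) μ (p ∥ q')

IsBisimulation : FSpec → (Proc → Proc → Set) → Set
IsBisimulation f ℛ = ∀ {p q} → ℛ p q →
  (∀ {μ p'} → Step f p μ p' → ∃ λ q' → Step f q μ q' × ℛ p' q') ×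
  (∀ {μ q'} → Step f q μ q' → ∃ λ p' → Step f p μ p' × ℛ p' q')

Bisim : FSpec → Proc → Proc → Set₁
Bisim f p q = Σ (Proc → Proc → Set) λ ℛ → IsBisimulation f ℛ × ℛ p q

Sound : FSpec → Tm ℕ → Tm ℕ → Set₁
Sound f t u = (σ : ℕ → CTm) → Bisim f (emb (sub σ t)) (emb (sub σ u))

HasZeroSummand : FSpec → CTm → Set₁
HasZeroSummand f p = Σ CTm λ l → Σ CTm λ r → ((l ⊕ r) ⊑ p) ×
  (Bisim f (emb l) 𝟎 ⊎ Bisim f (emb r) 𝟎)

HasZeroFactor : FSpec → CTm → Set₁
HasZeroFactor f p = Σ CTm λ l → Σ CTm λ r → (F l r ⊑ p) ×
  (Bisim f (emb l) 𝟎 ⊎ Bisim f (emb r) 𝟎)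

pow : Act → ℕ → CTm
pow μ zero = 𝟎
pow μ (suc m) = μ · pow μ m

powLe : Act → ℕ → CTm
powLe μ zero = 𝟎
powLe μ (suc zero) = pow μ 1
powLe μ (suc (suc i)) = powLe μ (suc i) ⊕ pow μ (suc (suc i))

pn : Name → ℕ → CTm
pn α zero = nm (bar α) · powLe (nm α) zero
pn α (suc n) = pn α n ⊕ (nm (bar α) · powLe (nm α) (suc n))

-- f(α, p_n)   (α abbreviates α.𝟎)
target : Name → ℕ → CTm
target α n = F (nm α · 𝟎) (pn α n)

-- Write T = f(α, p_n) and M = n + 2, an upper bound on the length of the traces of T.
-- A summand s ∼ T of σ(t) is either a summand of σ(x) for a variable summand x of t, or
-- σ(f(t₁, t₂)) for a summand f(t₁, t₂) of t (a 𝟎 or prefix summand cannot match both the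
-- α- and the ᾱ-move of T), and then σ(t₁) ∼ α and σ(t₂) ∼ p_n. As p_n has the n + 1 pairwise
-- non-bisimilar ᾱ-derivatives α^{≤j} while t₂ has fewer than n summands, in that case some
-- variable x is a summand of t₂. Now instantiate x by σ(x) + ᾱ.α^M instead: t gains an ᾱ-move
-- into α^M, resp. into the instance of t₁ ∥ α^M. Since σ(u) has no trace of length M + 1, u can
-- match it only through the new summand, which forces x to be a summand of u, resp. yields a
-- summand f(w₁, w₂) of u with σ(w₁) ∼ α and σ(w₂) ∼ p_n.

module Submission where

open import Defs
open import Data.Bool using (true; false) renaming (_≟_ to _≟ᴮ_)
open import Data.Nat using (ℕ; zero; suc; _+_; _<_; _≤_; _⊔_; z≤n; s≤s)
open import Data.Nat.Properties
open import Data.Nat.Induction using (<-wellFounded)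
open import Induction.WellFounded using (Acc; acc)
open import Data.Fin using (Fin; toℕ)
open import Data.Fin.Properties using (toℕ≤pred[n]; toℕ-injective; pigeonhole) renaming (<-irrefl to <ᶠ-irrefl)
open import Data.Product using (Σ; ∃; ∃₂; _×_; _,_; proj₁; proj₂)
open import Data.Sum as Sum using (_⊎_; inj₁; inj₂)
open import Data.Empty using (⊥-elim)
open import Data.List using (List; []; _∷_; length; lookup; replicate)
open import Data.List.Properties using (length-++; length-replicate)
open import Data.List.Membership.Propositional using (_∈_; _∉_; find; lose)
open import Data.List.Membership.Propositional.Properties using (∈-++⁺ˡ; ∈-++⁺ʳ; ∈-++⁻)
open import Data.List.Relation.Unary.Any using (here; any?; index)
open import Data.List.Relation.Unary.Any.Properties using (lookup-index)
open import Function using (id)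
open import Relation.Binary.PropositionalEquality
open import Relation.Nullary using (¬_; Dec; yes; no)
open import Relation.Nullary.Decidable using (map′; _×-dec_; _⊎-dec_)

bar-≢ : ∀ α → nm α ≢ nm (bar α)
bar-≢ a ()
bar-≢ ā ()

_≟ᴺ_ : (x y : Name) → Dec (x ≡ y)
a ≟ᴺ a = yes refl
a ≟ᴺ ā = no λ ()
ā ≟ᴺ a = no λ ()
ā ≟ᴺ ā = yes refl

_≟ᴬ_ : (μ ν : Act) → Dec (μ ≡ ν)
nm x ≟ᴬ nm y = map′ (cong nm) (λ { refl → refl }) (x ≟ᴺ y)
nm x ≟ᴬ τ = no λ ()
τ ≟ᴬ nm y = no λ ()
τ ≟ᴬ τ = yes refl

true≢false : ∀ {b} → b ≡ true → b ≢ false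
true≢false refl ()

data Rigid {V : Set} : Tm V → Set where
  𝟎 : Rigid 𝟎
  prefix : ∀ {μ w} → Rigid (μ · w)
  F : ∀ {w₁ w₂} → Rigid (F w₁ w₂)

module _ {V : Set} where

  ⊑-trans : {s t u : Tm V} → s ⊑ t → t ⊑ u → s ⊑ u
  ⊑-trans p here = p
  ⊑-trans p (inPre q) = inPre (⊑-trans p q)
  ⊑-trans p (inPlL q) = inPlL (⊑-trans p q)
  ⊑-trans p (inPlR q) = inPlR (⊑-trans p q)
  ⊑-trans p (inFL q) = inFL (⊑-trans p q)
  ⊑-trans p (inFR q) = inFR (⊑-trans p q)

  ⊑-sub : (σ : V → CTm) {s t : Tm V} → s ⊑ t → sub σ s ⊑ sub σ t
  ⊑-sub σ here = here
  ⊑-sub σ (inPre q) = inPre (⊑-sub σ q)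
  ⊑-sub σ (inPlL q) = inPlL (⊑-sub σ q)
  ⊑-sub σ (inPlR q) = inPlR (⊑-sub σ q)
  ⊑-sub σ (inFL q) = inFL (⊑-sub σ q)
  ⊑-sub σ (inFR q) = inFR (⊑-sub σ q)

  size-mono-⊑ : {s u : Tm V} → s ⊑ u → size s ≤ size u
  size-mono-⊑ here = ≤-refl
  size-mono-⊑ (inPre q) = m≤n⇒m≤1+n (size-mono-⊑ q)
  size-mono-⊑ {u = t ⊕ u} (inPlL q) = m≤n⇒m≤1+n (≤-trans (size-mono-⊑ q) (m≤m+n (size t) (size u)))
  size-mono-⊑ {u = t ⊕ u} (inPlR q) = m≤n⇒m≤1+n (≤-trans (size-mono-⊑ q) (m≤n+m (size u) (size t)))
  size-mono-⊑ {u = F t u} (inFL q) = m≤n⇒m≤1+n (≤-trans (size-mono-⊑ q) (m≤m+n (size t) (size u)))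
  size-mono-⊑ {u = F t u} (inFR q) = m≤n⇒m≤1+n (≤-trans (size-mono-⊑ q) (m≤n+m (size u) (size t)))

  length-summands≤1+size : (u : Tm V) → length (summands u) ≤ suc (size u)
  length-summands≤1+size (u ⊕ w) rewrite length-++ (summands u) {summands w} =
    ≤-trans (+-mono-≤ (length-summands≤1+size u) (length-summands≤1+size w))
            (s≤s (≤-reflexive (+-suc (size u) (size w))))
  length-summands≤1+size 𝟎 = s≤s z≤n
  length-summands≤1+size (var x) = s≤s z≤n
  length-summands≤1+size (μ · u) = s≤s z≤n
  length-summands≤1+size (F u w) = s≤s z≤n

  summand⇒⊑ : (u : Tm V) {v : Tm V} → v ∈ summands u → v ⊑ u
  summand⇒⊑ (u ⊕ w) v∈ with ∈-++⁻ (summands u) v∈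
  ... | inj₁ v∈u = inPlL (summand⇒⊑ u v∈u)
  ... | inj₂ v∈w = inPlR (summand⇒⊑ w v∈w)
  summand⇒⊑ 𝟎 (here refl) = here
  summand⇒⊑ (var x) (here refl) = here
  summand⇒⊑ (μ · u) (here refl) = here
  summand⇒⊑ (F u w) (here refl) = here

  summand-whole-or-operand : (u : Tm V) {v : Tm V} → v ∈ summands u →
    u ≡ v ⊎ ∃₂ λ l r → (l ⊕ r) ⊑ u × (l ≡ v ⊎ r ≡ v)
  summand-whole-or-operand (u ⊕ w) v∈ with ∈-++⁻ (summands u) v∈
  ... | inj₁ v∈u with summand-whole-or-operand u v∈u
  ...   | inj₁ refl = inj₂ (u , w , here , inj₁ refl)
  ...   | inj₂ (l , r , l⊕r⊑u , eq) = inj₂ (l , r , inPlL l⊕r⊑u , eq)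
  summand-whole-or-operand (u ⊕ w) v∈ | inj₂ v∈w with summand-whole-or-operand w v∈w
  ...   | inj₁ refl = inj₂ (u , w , here , inj₂ refl)
  ...   | inj₂ (l , r , l⊕r⊑w , eq) = inj₂ (l , r , inPlR l⊕r⊑w , eq)
  summand-whole-or-operand 𝟎 (here refl) = inj₁ refl
  summand-whole-or-operand (var x) (here refl) = inj₁ refl
  summand-whole-or-operand (μ · u) (here refl) = inj₁ refl
  summand-whole-or-operand (F u w) (here refl) = inj₁ refl

  summand-not-sum : (u : Tm V) {v w : Tm V} → (v ⊕ w) ∉ summands u
  summand-not-sum (u ⊕ w) v∈ with ∈-++⁻ (summands u) v∈
  ... | inj₁ v∈u = summand-not-sum u v∈u
  ... | inj₂ v∈w = summand-not-sum w v∈w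
  summand-not-sum 𝟎 (here ())
  summand-not-sum (var x) (here ())
  summand-not-sum (μ · u) (here ())
  summand-not-sum (F u w) (here ())

  private
    IsVar : Tm V → Set
    IsVar v = ∃ λ x → v ≡ var x

    isVar? : (v : Tm V) → Dec (IsVar v)
    isVar? (var x) = yes (x , refl)
    isVar? 𝟎 = no λ ()
    isVar? (μ · v) = no λ ()
    isVar? (v ⊕ w) = no λ ()
    isVar? (F v w) = no λ ()

  var-summand? : (u : Tm V) → (∃ λ x → var x ∈ summands u) ⊎ (∀ {x} → var x ∉ summands u)
  var-summand? u with any? isVar? (summands u)
  ... | yes some with find some
  ...   | _ , v∈ , x , refl = inj₁ (x , v∈)
  var-summand? u | no none = inj₂ λ x∈ → none (lose x∈ (_ , refl))

summands-sub : (σ : ℕ → CTm) (u : Tm ℕ) {v : Tm ℕ} {s : CTm} →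
  v ∈ summands u → s ∈ summands (sub σ v) → s ∈ summands (sub σ u)
summands-sub σ (u ⊕ w) v∈ s∈ with ∈-++⁻ (summands u) v∈
... | inj₁ v∈u = ∈-++⁺ˡ (summands-sub σ u v∈u s∈)
... | inj₂ v∈w = ∈-++⁺ʳ (summands (sub σ u)) (summands-sub σ w v∈w s∈)
summands-sub σ 𝟎 (here refl) s∈ = s∈
summands-sub σ (var x) (here refl) s∈ = s∈
summands-sub σ (μ · u) (here refl) s∈ = s∈
summands-sub σ (F u w) (here refl) s∈ = s∈

summand-sub-origin : (σ : ℕ → CTm) (t : Tm ℕ) {s : CTm} → s ∈ summands (sub σ t) →
  (∃ λ x → var x ∈ summands t × s ∈ summands (σ x)) ⊎
  (∃ λ v → v ∈ summands t × s ≡ sub σ v × Rigid v)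
summand-sub-origin σ (t ⊕ u) s∈ with ∈-++⁻ (summands (sub σ t)) s∈
... | inj₁ s∈t with summand-sub-origin σ t s∈t
...   | inj₁ (x , x∈ , s∈x) = inj₁ (x , ∈-++⁺ˡ x∈ , s∈x)
...   | inj₂ (v , v∈ , eq , r) = inj₂ (v , ∈-++⁺ˡ v∈ , eq , r)
summand-sub-origin σ (t ⊕ u) s∈ | inj₂ s∈u with summand-sub-origin σ u s∈u
...   | inj₁ (x , x∈ , s∈x) = inj₁ (x , ∈-++⁺ʳ (summands t) x∈ , s∈x)
...   | inj₂ (v , v∈ , eq , r) = inj₂ (v , ∈-++⁺ʳ (summands t) v∈ , eq , r)
summand-sub-origin σ 𝟎 (here refl) = inj₂ (𝟎 , here refl , refl , 𝟎)
summand-sub-origin σ (var x) s∈ = inj₁ (x , here refl , s∈)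
summand-sub-origin σ (μ · t) (here refl) = inj₂ (μ · t , here refl , refl , prefix)
summand-sub-origin σ (F t u) (here refl) = inj₂ (F t u , here refl , refl , F)

module Semantics (f : FSpec) where

  Enabled : Proc → Act → Set
  Enabled p μ = ∃ λ p' → Step f p μ p'

  depth : Proc → ℕ
  depth 𝟎 = 0
  depth (μ · p) = suc (depth p)
  depth (p ⊕ q) = depth p ⊔ depth q
  depth (p ∥ q) = depth p + depth q
  depth (F p q) = depth p + depth q

  depth-step : ∀ {p μ p'} → Step f p μ p' → depth p' < depth p
  depth-step pre = ≤-refl
  depth-step (sumL {p} {q} s) = <-≤-trans (depth-step s) (m≤m⊔n (depth p) (depth q))
  depth-step (sumR {p} {q} s) = <-≤-trans (depth-step s) (m≤n⊔m (depth p) (depth q))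
  depth-step (parL {q = q} s) = +-monoˡ-< (depth q) (depth-step s)
  depth-step (parR {p} s) = +-monoʳ-< (depth p) (depth-step s)
  depth-step (parS s₁ s₂) = +-mono-< (depth-step s₁) (depth-step s₂)
  depth-step (fS _ s₁ s₂) = +-mono-< (depth-step s₁) (depth-step s₂)
  depth-step (fL {q = q} _ s) = +-monoˡ-< (depth q) (depth-step s)
  depth-step (fR {p} _ s) = +-monoʳ-< (depth p) (depth-step s)

  -- Processes are finite, so bisimilarity is an inductive type.
  infix 4 _∼_ _≲_ _≳_

  data _∼_ (p q : Proc) : Set
  _≲_ _≳_ : Proc → Proc → Set

  p ≲ q = ∀ {μ p'} → Step f p μ p' → ∃ λ q' → Step f q μ q' × p' ∼ q'
  q ≳ p = ∀ {μ q'} → Step f q μ q' → ∃ λ p' → Step f p μ p' × p' ∼ q'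

  data _∼_ p q where
    bisim : p ≲ q → q ≳ p → p ∼ q

  ∼-forth : ∀ {p q} → p ∼ q → p ≲ q
  ∼-forth (bisim forth _) = forth

  ∼-back : ∀ {p q} → p ∼ q → q ≳ p
  ∼-back (bisim _ back) = back

  module _ {ℛ : Proc → Proc → Set} (isBisim : IsBisimulation f ℛ) where

    bisimulation⊆∼ : ∀ {p q} → ℛ p q → p ∼ q
    bisimulation⊆∼ {p} = go (<-wellFounded (depth p))
      where
      go : ∀ {p q} → Acc _<_ (depth p) → ℛ p q → p ∼ q
      go (acc rec) r = bisim
        (λ s → let (q' , s' , r') = proj₁ (isBisim r) s in q' , s' , go (rec (depth-step s)) r')
        (λ s → let (p' , s' , r') = proj₂ (isBisim r) s in p' , s' , go (rec (depth-step s')) r')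

  Bisim⇒∼ : ∀ {p q} → Bisim f p q → p ∼ q
  Bisim⇒∼ (_ , isBisim , r) = bisimulation⊆∼ isBisim r

  ∼⇒Bisim : ∀ {p q} → p ∼ q → Bisim f p q
  ∼⇒Bisim b = _∼_ , (λ b → ∼-forth b , ∼-back b) , b

  ∼-refl : ∀ {p} → p ∼ p
  ∼-refl = bisimulation⊆∼ {ℛ = _≡_} (λ { refl → (λ s → _ , s , refl) , (λ s → _ , s , refl) }) refl

  ∼-sym : ∀ {p q} → p ∼ q → q ∼ p
  ∼-sym (bisim forth back) =
    bisim (λ s → let (p' , s' , b) = back s in p' , s' , ∼-sym b)
          (λ s → let (q' , s' , b) = forth s in q' , s' , ∼-sym b)

  ∼-trans : ∀ {p q r} → p ∼ q → q ∼ r → p ∼ r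
  ∼-trans (bisim forth₁ back₁) (bisim forth₂ back₂) =
    bisim (λ s → let (_ , s' , b) = forth₁ s ; (r' , s'' , c) = forth₂ s' in r' , s'' , ∼-trans b c)
          (λ s → let (_ , s' , c) = back₂ s ; (p' , s'' , b) = back₁ s' in p' , s'' , ∼-trans b c)

  ∥-cong : ∀ {p p' q q'} → p ∼ p' → q ∼ q' → p ∥ q ∼ p' ∥ q'
  ∥-forth : ∀ {p p' q q'} → p ∼ p' → q ∼ q' → p ∥ q ≲ p' ∥ q'
  ∥-back : ∀ {p p' q q'} → p ∼ p' → q ∼ q' → p' ∥ q' ≳ p ∥ q

  ∥-cong bp bq = bisim (∥-forth bp bq) (∥-back bp bq)

  ∥-forth (bisim forth _) bq (parL s) = let (_ , s' , b) = forth s in _ , parL s' , ∥-cong b bq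
  ∥-forth bp (bisim forth _) (parR s) = let (_ , s' , b) = forth s in _ , parR s' , ∥-cong bp b
  ∥-forth (bisim forthp _) (bisim forthq _) (parS s₁ s₂) =
    let (_ , s₁' , b₁) = forthp s₁ ; (_ , s₂' , b₂) = forthq s₂ in _ , parS s₁' s₂' , ∥-cong b₁ b₂

  ∥-back (bisim _ back) bq (parL s) = let (_ , s' , b) = back s in _ , parL s' , ∥-cong b bq
  ∥-back bp (bisim _ back) (parR s) = let (_ , s' , b) = back s in _ , parR s' , ∥-cong bp b
  ∥-back (bisim _ backp) (bisim _ backq) (parS s₁ s₂) =
    let (_ , s₁' , b₁) = backp s₁ ; (_ , s₂' , b₂) = backq s₂ in _ , parS s₁' s₂' , ∥-cong b₁ b₂

  F-cong : ∀ {p p' q q'} → p ∼ p' → q ∼ q' → F p q ∼ F p' q'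
  F-cong {p} {p'} {q} {q'} bp bq = bisim forth back
    where
    forth : F p q ≲ F p' q'
    forth (fL h s) = let (_ , s' , b) = ∼-forth bp s in _ , fL h s' , ∥-cong b bq
    forth (fR h s) = let (_ , s' , b) = ∼-forth bq s in _ , fR h s' , ∥-cong bp b
    forth (fS h s₁ s₂) = let (_ , s₁' , b₁) = ∼-forth bp s₁ ; (_ , s₂' , b₂) = ∼-forth bq s₂
                         in _ , fS h s₁' s₂' , ∥-cong b₁ b₂
    back : F p' q' ≳ F p q
    back (fL h s) = let (_ , s' , b) = ∼-back bp s in _ , fL h s' , ∥-cong b bq
    back (fR h s) = let (_ , s' , b) = ∼-back bq s in _ , fR h s' , ∥-cong bp b
    back (fS h s₁ s₂) = let (_ , s₁' , b₁) = ∼-back bp s₁ ; (_ , s₂' , b₂) = ∼-back bq s₂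
                        in _ , fS h s₁' s₂' , ∥-cong b₁ b₂

  stuck⇒∼𝟎 : ∀ {p} → (∀ {μ p'} → ¬ Step f p μ p') → p ∼ 𝟎
  stuck⇒∼𝟎 stuck = bisim (λ s → ⊥-elim (stuck s)) λ ()

  ∼𝟎⇒stuck : ∀ {p μ p'} → p ∼ 𝟎 → ¬ Step f p μ p'
  ∼𝟎⇒stuck b s with ∼-forth b s
  ... | _ , () , _

  ∥-identityˡ : ∀ {p} → 𝟎 ∥ p ∼ p
  ∥-identityˡ = bisimulation⊆∼ {ℛ = λ r p → r ≡ 𝟎 ∥ p}
    (λ { refl → (λ { (parR s) → _ , s , refl }) , (λ s → _ , parR s , refl) }) refl

  ∥-identityʳ : ∀ {p} → p ∥ 𝟎 ∼ p
  ∥-identityʳ = bisimulation⊆∼ {ℛ = λ r p → r ≡ p ∥ 𝟎}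
    (λ { refl → (λ { (parL s) → _ , s , refl }) , (λ s → _ , parL s , refl) }) refl

  ∼𝟎-∥ˡ : ∀ {p q} → p ∼ 𝟎 → p ∥ q ∼ q
  ∼𝟎-∥ˡ p∼𝟎 = ∼-trans (∥-cong p∼𝟎 ∼-refl) ∥-identityˡ

  ∼𝟎-∥ʳ : ∀ {p q} → q ∼ 𝟎 → p ∥ q ∼ p
  ∼𝟎-∥ʳ q∼𝟎 = ∼-trans (∥-cong ∼-refl q∼𝟎) ∥-identityʳ

  ∥∼𝟎⇒ˡ : ∀ {p q} → p ∥ q ∼ 𝟎 → p ∼ 𝟎
  ∥∼𝟎⇒ˡ b = stuck⇒∼𝟎 λ s → ∼𝟎⇒stuck b (parL s)

  ∥∼𝟎⇒ʳ : ∀ {p q} → p ∥ q ∼ 𝟎 → q ∼ 𝟎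
  ∥∼𝟎⇒ʳ b = stuck⇒∼𝟎 λ s → ∼𝟎⇒stuck b (parR s)

  private
    ∃-Name? : {P : Name → Set} → (∀ β → Dec (P β)) → Dec (∃ P)
    ∃-Name? P? = map′ (λ { (inj₁ x) → a , x ; (inj₂ x) → ā , x })
                      (λ { (a , x) → inj₁ x ; (ā , x) → inj₂ x })
                      (P? a ⊎-dec P? ā)

  enabled? : ∀ p μ → Dec (Enabled p μ)
  enabled? 𝟎 μ = no λ ()
  enabled? (ν · p) μ = map′ (λ { refl → p , pre }) (λ { (_ , pre) → refl }) (ν ≟ᴬ μ)
  enabled? (p ⊕ q) μ = map′
    (λ { (inj₁ (_ , s)) → _ , sumL s ; (inj₂ (_ , s)) → _ , sumR s })
    (λ { (_ , sumL s) → inj₁ (_ , s) ; (_ , sumR s) → inj₂ (_ , s) })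
    (enabled? p μ ⊎-dec enabled? q μ)
  enabled? (p ∥ q) μ = map′
    (λ { (inj₁ (_ , s)) → _ , parL s
       ; (inj₂ (inj₁ (_ , s))) → _ , parR s
       ; (inj₂ (inj₂ (refl , _ , (_ , s₁) , (_ , s₂)))) → _ , parS s₁ s₂ })
    (λ { (_ , parL s) → inj₁ (_ , s)
       ; (_ , parR s) → inj₂ (inj₁ (_ , s))
       ; (_ , parS s₁ s₂) → inj₂ (inj₂ (refl , _ , (_ , s₁) , (_ , s₂))) })
    (enabled? p μ ⊎-dec enabled? q μ ⊎-dec
      ((μ ≟ᴬ τ) ×-dec ∃-Name? λ β → enabled? p (nm β) ×-dec enabled? q (nm (bar β))))
  enabled? (F p q) μ = map′
    (λ { (inj₁ (h , _ , s)) → _ , fL h s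
       ; (inj₂ (inj₁ (h , _ , s))) → _ , fR h s
       ; (inj₂ (inj₂ (refl , _ , h , (_ , s₁) , (_ , s₂)))) → _ , fS h s₁ s₂ })
    (λ { (_ , fL h s) → inj₁ (h , _ , s)
       ; (_ , fR h s) → inj₂ (inj₁ (h , _ , s))
       ; (_ , fS h s₁ s₂) → inj₂ (inj₂ (refl , _ , h , (_ , s₁) , (_ , s₂))) })
    (((L f μ ≟ᴮ true) ×-dec enabled? p μ) ⊎-dec ((R f μ ≟ᴮ true) ×-dec enabled? q μ) ⊎-dec
      ((μ ≟ᴬ τ) ×-dec ∃-Name? λ β →
        (S f β ≟ᴮ true) ×-dec enabled? p (nm β) ×-dec enabled? q (nm (bar β))))

  ≁𝟎⇒enabled : ∀ {p} → ¬ p ∼ 𝟎 → ∃ (Enabled p)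
  ≁𝟎⇒enabled {p} p≁𝟎 with enabled? p (nm a) | enabled? p (nm ā) | enabled? p τ
  ... | yes e | _ | _ = _ , e
  ... | no _ | yes e | _ = _ , e
  ... | no _ | no _ | yes e = _ , e
  ... | no ¬a | no ¬ā | no ¬τ = ⊥-elim (p≁𝟎 (stuck⇒∼𝟎 stuck))
    where
    stuck : ∀ {μ p'} → ¬ Step f p μ p'
    stuck {nm a} s = ¬a (_ , s)
    stuck {nm ā} s = ¬ā (_ , s)
    stuck {τ} s = ¬τ (_ , s)

  infixr 5 _∷_

  data Trace : Proc → List Act → Set where
    [] : ∀ {p} → Trace p []
    _∷_ : ∀ {p μ p' w} → Step f p μ p' → Trace p' w → Trace p (μ ∷ w)

  trace-length≤depth : ∀ {p w} → Trace p w → length w ≤ depth p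
  trace-length≤depth [] = z≤n
  trace-length≤depth (s ∷ tr) = ≤-trans (s≤s (trace-length≤depth tr)) (depth-step s)

  ∼-trace : ∀ {p q w} → p ∼ q → Trace p w → Trace q w
  ∼-trace b [] = []
  ∼-trace b (s ∷ tr) = let (_ , s' , b') = ∼-forth b s in s' ∷ ∼-trace b' tr

  ∼-trace-length≤depth : ∀ {p q w} → p ∼ q → Trace p w → length w ≤ depth q
  ∼-trace-length≤depth b tr = trace-length≤depth (∼-trace b tr)

  trace-∥ˡ : ∀ {p q w} → Trace p w → Trace (p ∥ q) w
  trace-∥ˡ [] = []
  trace-∥ˡ (s ∷ tr) = parL s ∷ trace-∥ˡ tr

  trace-∥ʳ : ∀ {p q w} → Trace q w → Trace (p ∥ q) w
  trace-∥ʳ [] = []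
  trace-∥ʳ (s ∷ tr) = parR s ∷ trace-∥ʳ tr

  infix 4 _∈∥_

  data _∈∥_ (q : Proc) : Proc → Set where
    here : q ∈∥ q
    left : ∀ {p₁ p₂} → q ∈∥ p₁ → q ∈∥ p₁ ∥ p₂
    right : ∀ {p₁ p₂} → q ∈∥ p₂ → q ∈∥ p₁ ∥ p₂

  ∈∥-trace : ∀ {q p w} → q ∈∥ p → Trace q w → Trace p w
  ∈∥-trace here tr = tr
  ∈∥-trace (left i) tr = trace-∥ˡ (∈∥-trace i tr)
  ∈∥-trace (right i) tr = trace-∥ʳ (∈∥-trace i tr)

  step-from-summand : (ρ : ℕ → CTm) (u : Tm ℕ) {v : Tm ℕ} {μ : Act} {r : Proc} →
    v ∈ summands u → Step f (emb (sub ρ v)) μ r → Step f (emb (sub ρ u)) μ r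
  step-from-summand ρ (u ⊕ w) v∈ s with ∈-++⁻ (summands u) v∈
  ... | inj₁ v∈u = sumL (step-from-summand ρ u v∈u s)
  ... | inj₂ v∈w = sumR (step-from-summand ρ w v∈w s)
  step-from-summand ρ 𝟎 (here refl) s = s
  step-from-summand ρ (var x) (here refl) s = s
  step-from-summand ρ (μ · u) (here refl) s = s
  step-from-summand ρ (F u w) (here refl) s = s

  step-via-summand : (ρ : ℕ → CTm) (u : Tm ℕ) {μ : Act} {r : Proc} → Step f (emb (sub ρ u)) μ r →
    ∃ λ v → v ∈ summands u × Step f (emb (sub ρ v)) μ r
  step-via-summand ρ (u ⊕ w) (sumL s) = let (v , v∈ , s') = step-via-summand ρ u s in v , ∈-++⁺ˡ v∈ , s'
  step-via-summand ρ (u ⊕ w) (sumR s) =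
    let (v , v∈ , s') = step-via-summand ρ w s in v , ∈-++⁺ʳ (summands u) v∈ , s'
  step-via-summand ρ 𝟎 ()
  step-via-summand ρ (var x) s = var x , here refl , s
  step-via-summand ρ (μ · u) s = μ · u , here refl , s
  step-via-summand ρ (F u w) s = F u w , here refl , s

  summand-≲ : (ρ : ℕ → CTm) (u : Tm ℕ) {v : Tm ℕ} {q : Proc} →
    v ∈ summands u → emb (sub ρ u) ∼ q → emb (sub ρ v) ≲ q
  summand-≲ ρ u v∈ b s = ∼-forth b (step-from-summand ρ u v∈ s)

  zero-summand : (σ : ℕ → CTm) {u l r : Tm ℕ} → (l ⊕ r) ⊑ u →
    emb (sub σ l) ∼ 𝟎 ⊎ emb (sub σ r) ∼ 𝟎 → HasZeroSummand f (sub σ u)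
  zero-summand σ {l = l} {r} l⊕r⊑u z = sub σ l , sub σ r , ⊑-sub σ l⊕r⊑u , Sum.map ∼⇒Bisim ∼⇒Bisim z

  zero-factor : (σ : ℕ → CTm) {u l r : Tm ℕ} → F l r ⊑ u →
    emb (sub σ l) ∼ 𝟎 ⊎ emb (sub σ r) ∼ 𝟎 → HasZeroFactor f (sub σ u)
  zero-factor σ {l = l} {r} Flr⊑u z = sub σ l , sub σ r , ⊑-sub σ Flr⊑u , Sum.map ∼⇒Bisim ∼⇒Bisim z

distinct-witnesses≤length : ∀ {A : Set} {m} (xs : List A) (W : Fin m → A → Set) →
  (∀ i → ∃ λ v → v ∈ xs × W i v) → (∀ {i j v} → v ∈ xs → W i v → W j v → i ≡ j) →
  m ≤ length xs
distinct-witnesses≤length {m = m} xs W witness unique with m ≤? length xs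
... | yes m≤ = m≤
... | no m≰ with pigeonhole (≰⇒> m≰) (λ i → index (proj₁ (proj₂ (witness i))))
... | i , j , i<j , same-index = ⊥-elim (<ᶠ-irrefl i≡j i<j)
  where
  vᵢ≡vⱼ : proj₁ (witness i) ≡ proj₁ (witness j)
  vᵢ≡vⱼ = trans (lookup-index (proj₁ (proj₂ (witness i))))
                (trans (cong (lookup xs) same-index) (sym (lookup-index (proj₁ (proj₂ (witness j))))))
  i≡j : i ≡ j
  i≡j = unique (proj₁ (proj₂ (witness i))) (proj₂ (proj₂ (witness i)))
               (subst (W j) (sym vᵢ≡vⱼ) (proj₂ (proj₂ (witness j))))

module PnTerms (f : FSpec) (α : Name) where
  open Semantics f

  αs : ℕ → List Act
  αs k = replicate k (nm α)

  PL : ℕ → Proc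
  PL j = emb (powLe (nm α) j)

  PN : ℕ → Proc
  PN k = emb (pn α k)

  prefix-step-label : ∀ {μ ν p p'} → Step f (μ · p) ν p' → μ ≡ ν
  prefix-step-label pre = refl

  pow-step-label : ∀ {μ ν m r} → Step f (emb (pow μ m)) ν r → ν ≡ μ
  pow-step-label {m = suc m} pre = refl

  pow-trace : ∀ μ m → Trace (emb (pow μ m)) (replicate m μ)
  pow-trace μ zero = []
  pow-trace μ (suc m) = pre ∷ pow-trace μ m

  depth-pow : ∀ μ m → depth (emb (pow μ m)) ≡ m
  depth-pow μ zero = refl
  depth-pow μ (suc m) = cong suc (depth-pow μ m)

  powLe-step-label : ∀ {j ν r} → Step f (PL j) ν r → ν ≡ nm α
  powLe-step-label {suc zero} s = pow-step-label {m = 1} s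
  powLe-step-label {suc (suc j)} (sumL s) = powLe-step-label {suc j} s
  powLe-step-label {suc (suc j)} (sumR s) = pow-step-label {m = suc (suc j)} s

  powLe-trace : ∀ j → Trace (PL j) (αs j)
  powLe-trace zero = []
  powLe-trace (suc zero) = pre ∷ []
  powLe-trace (suc (suc j)) = sumR pre ∷ pow-trace (nm α) (suc j)

  depth-powLe : ∀ j → depth (PL j) ≤ j
  depth-powLe zero = z≤n
  depth-powLe (suc zero) = s≤s z≤n
  depth-powLe (suc (suc j)) =
    ⊔-lub (m≤n⇒m≤1+n (depth-powLe (suc j))) (≤-reflexive (depth-pow (nm α) (suc (suc j))))

  powLe-injective : ∀ {i j} → PL i ∼ PL j → i ≡ j
  powLe-injective {i} {j} b = ≤-antisym (bound b (powLe-trace i)) (bound (∼-sym b) (powLe-trace j))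
    where
    bound : ∀ {k l} → PL k ∼ PL l → Trace (PL k) (αs k) → k ≤ l
    bound {k} {l} b tr = ≤-trans (≤-trans (≤-reflexive (sym (length-replicate k)))
                                          (∼-trace-length≤depth b tr)) (depth-powLe l)

  pn-step-inv : ∀ k {μ r} → Step f (PN k) μ r → μ ≡ nm (bar α) × ∃ λ j → r ≡ PL j
  pn-step-inv zero pre = refl , zero , refl
  pn-step-inv (suc k) (sumL s) = pn-step-inv k s
  pn-step-inv (suc k) (sumR pre) = refl , suc k , refl

  pn-step : ∀ {k j} → j ≤ k → Step f (PN k) (nm (bar α)) (PL j)
  pn-step {zero} z≤n = pre
  pn-step {suc k} {j} j≤1+k with j ≟ suc k
  ... | yes refl = sumR pre
  ... | no j≢1+k = sumL (pn-step (≤-pred (≤∧≢⇒< j≤1+k j≢1+k)))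

  depth-pn : ∀ k → depth (PN k) ≤ suc k
  depth-pn zero = s≤s z≤n
  depth-pn (suc k) = ⊔-lub (m≤n⇒m≤1+n (depth-pn k)) (s≤s (depth-powLe (suc k)))

module Target (f : FSpec) (α : Name)
  (Lα : L f (nm α) ≡ true) (¬Rα : R f (nm α) ≡ false)
  (Rᾱ : R f (nm (bar α)) ≡ true) (¬Lᾱ : L f (nm (bar α)) ≡ false)
  (n : ℕ) where
  open Semantics f
  open PnTerms f α

  T : Proc
  T = emb (target α n)

  SummandBisimilarToTarget : CTm → Set₁
  SummandBisimilarToTarget c = Σ CTm λ s → (s ∈ summands c) × Bisim f (emb s) T

  target-α : Step f T (nm α) (𝟎 ∥ PN n)
  target-α = fL Lα pre

  target-ᾱ : Step f T (nm (bar α)) ((nm α · 𝟎) ∥ 𝟎)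
  target-ᾱ = fR Rᾱ (pn-step z≤n)

  target-α-inv : ∀ {r} → Step f T (nm α) r → r ≡ 𝟎 ∥ PN n
  target-α-inv (fL _ pre) = refl
  target-α-inv (fR h _) = ⊥-elim (true≢false h ¬Rα)

  target-ᾱ-inv : ∀ {r} → Step f T (nm (bar α)) r → ∃ λ j → r ≡ (nm α · 𝟎) ∥ PL j
  target-ᾱ-inv (fL h _) = ⊥-elim (true≢false h ¬Lᾱ)
  target-ᾱ-inv (fR _ s) with pn-step-inv n s
  ... | _ , j , refl = j , refl

  depth-target : depth T ≤ 2 + n
  depth-target = s≤s (depth-pn n)

  ∥∼pn⇒factor∼𝟎 : ∀ {p q} → p ∥ q ∼ PN n → p ∼ 𝟎 ⊎ q ∼ 𝟎
  ∥∼pn⇒factor∼𝟎 b with ∼-back b (pn-step z≤n)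
  ... | _ , parL _ , b' = inj₂ (∥∼𝟎⇒ʳ b')
  ... | _ , parR _ , b' = inj₁ (∥∼𝟎⇒ˡ b')

  -- The α-step of f(s₁, s₂) forces s₂ ∼ p_n, and the ᾱ-step of s₂ to 𝟎 then exposes s₁ itself.
  target-components : ∀ {s₁ s₂} → F s₁ s₂ ≲ T → ¬ s₂ ∼ 𝟎 → Enabled s₁ (nm α) →
    s₁ ∼ nm α · 𝟎 × s₂ ∼ PN n
  target-components {s₁} {s₂} F≲T s₂≁𝟎 (_ , s₁-α) = s₁∼α , s₂∼pn
    where
    after-α : ∀ {s₁'} → Step f s₁ (nm α) s₁' → s₁' ∼ 𝟎 × s₂ ∼ PN n
    after-α s with F≲T (fL Lα s)
    ... | _ , sT , b with target-α-inv sT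
    ... | refl with ∥∼pn⇒factor∼𝟎 (∼-trans b ∥-identityˡ)
    ...   | inj₁ s₁'∼𝟎 = s₁'∼𝟎 , ∼-trans (∼-sym (∼𝟎-∥ˡ s₁'∼𝟎)) (∼-trans b ∥-identityˡ)
    ...   | inj₂ s₂∼𝟎 = ⊥-elim (s₂≁𝟎 s₂∼𝟎)

    s₂∼pn : s₂ ∼ PN n
    s₂∼pn = proj₂ (after-α s₁-α)

    s₁∼α∥PL : ∃ λ j → s₁ ∼ (nm α · 𝟎) ∥ PL j
    s₁∼α∥PL with ∼-back s₂∼pn (pn-step z≤n)
    ... | _ , s₂-ᾱ , s₂'∼𝟎 with F≲T (fR Rᾱ s₂-ᾱ)
    ... | _ , sT , b with target-ᾱ-inv sT
    ... | j , refl = j , ∼-trans (∼-sym (∼𝟎-∥ʳ s₂'∼𝟎)) b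

    s₁∼α : s₁ ∼ nm α · 𝟎
    s₁∼α with s₁∼α∥PL
    ... | j , b with ∼-back b (parL pre)
    ... | _ , s , b' = ∼-trans b (∼𝟎-∥ʳ (∥∼𝟎⇒ʳ (∼-trans (∼-sym b') (proj₁ (after-α s)))))

-- Ext r′ r: r′ is r with some occurrences of P replaced by P ⊕ ν.Y.
module Extension (f : FSpec) (P Y : Proc) (ν : Act) where
  open Semantics f

  data Ext : Proc → Proc → Set where
    leaf : Ext (P ⊕ ν · Y) P
    ext-refl : ∀ {r} → Ext r r
    prefix : ∀ {μ r' r} → Ext r' r → Ext (μ · r') (μ · r)
    _⊕_ : ∀ {r₁' r₁ r₂' r₂} → Ext r₁' r₁ → Ext r₂' r₂ → Ext (r₁' ⊕ r₂') (r₁ ⊕ r₂)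
    _∥_ : ∀ {r₁' r₁ r₂' r₂} → Ext r₁' r₁ → Ext r₂' r₂ → Ext (r₁' ∥ r₂') (r₁ ∥ r₂)
    F : ∀ {r₁' r₁ r₂' r₂} → Ext r₁' r₁ → Ext r₂' r₂ → Ext (F r₁' r₂') (F r₁ r₂)

  ext-forth : ∀ {r' r μ s} → Ext r' r → Step f r μ s → ∃ λ s' → Step f r' μ s' × Ext s' s
  ext-forth leaf s = _ , sumL s , ext-refl
  ext-forth ext-refl s = _ , s , ext-refl
  ext-forth (prefix e) pre = _ , pre , e
  ext-forth (e₁ ⊕ e₂) (sumL s) = let (_ , s' , e) = ext-forth e₁ s in _ , sumL s' , e
  ext-forth (e₁ ⊕ e₂) (sumR s) = let (_ , s' , e) = ext-forth e₂ s in _ , sumR s' , e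
  ext-forth (e₁ ∥ e₂) (parL s) = let (_ , s' , e) = ext-forth e₁ s in _ , parL s' , e ∥ e₂
  ext-forth (e₁ ∥ e₂) (parR s) = let (_ , s' , e) = ext-forth e₂ s in _ , parR s' , e₁ ∥ e
  ext-forth (e₁ ∥ e₂) (parS s₁ s₂) =
    let (_ , s₁' , e₁') = ext-forth e₁ s₁ ; (_ , s₂' , e₂') = ext-forth e₂ s₂
    in _ , parS s₁' s₂' , e₁' ∥ e₂'
  ext-forth (F e₁ e₂) (fL h s) = let (_ , s' , e) = ext-forth e₁ s in _ , fL h s' , e ∥ e₂
  ext-forth (F e₁ e₂) (fR h s) = let (_ , s' , e) = ext-forth e₂ s in _ , fR h s' , e₁ ∥ e
  ext-forth (F e₁ e₂) (fS h s₁ s₂) =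
    let (_ , s₁' , e₁') = ext-forth e₁ s₁ ; (_ , s₂' , e₂') = ext-forth e₂ s₂
    in _ , fS h s₁' s₂' , e₁' ∥ e₂'

  -- A step of r′ that r cannot mimic uses a new ν-summand (possibly in a synchronisation).
  record Fresh (r : Proc) (μ : Act) (s' : Proc) : Set where
    field
      label : μ ≡ ν ⊎ μ ≡ τ
      residual : Y ∈∥ s'
      inherited : Enabled P ν → Enabled r μ

  open Fresh

  Back : Proc → Act → Proc → Set
  Back r μ s' = (∃ λ s → Step f r μ s × Ext s' s) ⊎ Fresh r μ s'

  private
    back-enabled : ∀ {r μ s'} → Back r μ s' → Enabled P ν → Enabled r μ
    back-enabled (inj₁ (_ , s , _)) _ = _ , s
    back-enabled (inj₂ fr) = inherited fr

    fresh-lift : ∀ {r₁ r μ s₁' s'} → (∀ {s} → Step f r₁ μ s → Enabled r μ) →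
      (Y ∈∥ s₁' → Y ∈∥ s') → Fresh r₁ μ s₁' → Fresh r μ s'
    fresh-lift lift wrap fr = record
      { label = label fr ; residual = wrap (residual fr) ; inherited = λ e → lift (proj₂ (inherited fr e)) }

    sync-back : ∀ {r r₁ r₂ s₁' s₂' β} →
      (∀ {s₁ s₂} → Step f r₁ (nm β) s₁ → Step f r₂ (nm (bar β)) s₂ → Step f r τ (s₁ ∥ s₂)) →
      Back r₁ (nm β) s₁' → Back r₂ (nm (bar β)) s₂' → Back r τ (s₁' ∥ s₂')
    sync-back sync (inj₁ (_ , s₁ , e₁)) (inj₁ (_ , s₂ , e₂)) = inj₁ (_ , sync s₁ s₂ , e₁ ∥ e₂)
    sync-back sync (inj₂ fr) b₂ = inj₂ record
      { label = inj₂ refl ; residual = left (residual fr)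
      ; inherited = λ e → _ , sync (proj₂ (inherited fr e)) (proj₂ (back-enabled b₂ e)) }
    sync-back sync b₁@(inj₁ _) (inj₂ fr) = inj₂ record
      { label = inj₂ refl ; residual = right (residual fr)
      ; inherited = λ e → _ , sync (proj₂ (back-enabled b₁ e)) (proj₂ (inherited fr e)) }

  ext-back : ∀ {r' r μ s'} → Ext r' r → Step f r' μ s' → Back r μ s'
  ext-back leaf (sumL s) = inj₁ (_ , s , ext-refl)
  ext-back leaf (sumR pre) = inj₂ record { label = inj₁ refl ; residual = here ; inherited = id }
  ext-back ext-refl s = inj₁ (_ , s , ext-refl)
  ext-back (prefix e) pre = inj₁ (_ , pre , e)
  ext-back (e₁ ⊕ e₂) (sumL s) =
    Sum.map (λ (_ , s' , e) → _ , sumL s' , e) (fresh-lift (λ s' → _ , sumL s') id) (ext-back e₁ s)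
  ext-back (e₁ ⊕ e₂) (sumR s) =
    Sum.map (λ (_ , s' , e) → _ , sumR s' , e) (fresh-lift (λ s' → _ , sumR s') id) (ext-back e₂ s)
  ext-back (e₁ ∥ e₂) (parL s) =
    Sum.map (λ (_ , s' , e) → _ , parL s' , e ∥ e₂) (fresh-lift (λ s' → _ , parL s') left) (ext-back e₁ s)
  ext-back (e₁ ∥ e₂) (parR s) =
    Sum.map (λ (_ , s' , e) → _ , parR s' , e₁ ∥ e) (fresh-lift (λ s' → _ , parR s') right) (ext-back e₂ s)
  ext-back (e₁ ∥ e₂) (parS s₁ s₂) = sync-back parS (ext-back e₁ s₁) (ext-back e₂ s₂)
  ext-back (F e₁ e₂) (fL h s) =
    Sum.map (λ (_ , s' , e) → _ , fL h s' , e ∥ e₂) (fresh-lift (λ s' → _ , fL h s') left) (ext-back e₁ s)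
  ext-back (F e₁ e₂) (fR h s) =
    Sum.map (λ (_ , s' , e) → _ , fR h s' , e₁ ∥ e) (fresh-lift (λ s' → _ , fR h s') right) (ext-back e₂ s)
  ext-back (F e₁ e₂) (fS h s₁ s₂) = sync-back (fS h) (ext-back e₁ s₁) (ext-back e₂ s₂)

  ext-trace : ∀ {β r' r} k → nm β ≢ ν → Ext r' r →
    Trace r' (replicate k (nm β)) → Trace r (replicate k (nm β))
  ext-trace zero _ _ [] = []
  ext-trace (suc k) β≢ν e (s ∷ tr) with ext-back e s
  ... | inj₁ (_ , s' , e') = s' ∷ ext-trace k β≢ν e' tr
  ... | inj₂ fr with label fr
  ...   | inj₁ β≡ν = ⊥-elim (β≢ν β≡ν)

module SummandPreservation (f : FSpec) (α : Name)
  (Lα : L f (nm α) ≡ true) (¬Rα : R f (nm α) ≡ false)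
  (Rᾱ : R f (nm (bar α)) ≡ true) (¬Lᾱ : L f (nm (bar α)) ≡ false)
  (t u : Tm ℕ) (sound : Sound f t u) (σ : ℕ → CTm)
  (¬𝟎summand-t : ¬ HasZeroSummand f (sub σ t)) (¬𝟎factor-t : ¬ HasZeroFactor f (sub σ t))
  (¬𝟎factor-u : ¬ HasZeroFactor f (sub σ u))
  (n : ℕ) (size-t<n : size t < n)
  (σu∼T : Semantics._∼_ f (emb (sub σ u)) (emb (target α n))) where

  open Semantics f
  open PnTerms f α
  open Target f α Lα ¬Rα Rᾱ ¬Lᾱ n

  M : ℕ
  M = 2 + n

  Y : Proc
  Y = emb (pow (nm α) M)

  private
    too-long : ∀ {p q μ} → p ∼ q → depth q ≤ M → ¬ Trace p (μ ∷ αs M)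
    too-long b depth≤M tr = 1+n≰n (≤-trans (≤-trans (≤-reflexive (cong suc (sym (length-replicate M))))
                                                    (∼-trace-length≤depth b tr)) depth≤M)

  σu-too-long : ∀ {μ} → ¬ Trace (emb (sub σ u)) (μ ∷ αs M)
  σu-too-long = too-long σu∼T depth-target

  ∼Y-too-long : ∀ {p μ} → p ∼ Y → ¬ Trace p (μ ∷ αs M)
  ∼Y-too-long b = too-long b (≤-reflexive (depth-pow (nm α) M))

  F-summand-match : ∀ {w₁ w₂} → F w₁ w₂ ∈ summands u → Enabled (emb (sub σ w₁)) (nm α) →
    SummandBisimilarToTarget (sub σ u)
  F-summand-match {w₁} {w₂} F∈ enabled =
    let (σw₁∼α , σw₂∼pn) = target-components (summand-≲ σ u F∈ σu∼T) σw₂≁𝟎 enabled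
    in sub σ (F w₁ w₂) , summands-sub σ u F∈ (here refl) , ∼⇒Bisim (F-cong σw₁∼α σw₂∼pn)
    where
    σw₂≁𝟎 : ¬ emb (sub σ w₂) ∼ 𝟎
    σw₂≁𝟎 z = ¬𝟎factor-u (zero-factor σ (summand⇒⊑ u F∈) (inj₂ z))

  module FreshSummandAt (x : ℕ) where

    ρ : ℕ → CTm
    ρ y with y ≟ x
    ... | yes _ = σ x ⊕ nm (bar α) · pow (nm α) M
    ... | no _ = σ y

    open Extension f (emb (σ x)) Y (nm (bar α))

    ext : ∀ w → Ext (emb (sub ρ w)) (emb (sub σ w))
    ext 𝟎 = ext-refl
    ext (var y) with y ≟ x
    ... | yes refl = leaf
    ... | no _ = ext-refl
    ext (μ · w) = prefix (ext w)
    ext (w₁ ⊕ w₂) = ext w₁ ⊕ ext w₂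
    ext (F w₁ w₂) = F (ext w₁) (ext w₂)

    ρx-ᾱ : Step f (emb (ρ x)) (nm (bar α)) Y
    ρx-ᾱ with x ≟ x
    ... | yes _ = sumR pre
    ... | no x≢x = ⊥-elim (x≢x refl)

    ρt∼ρu : emb (sub ρ t) ∼ emb (sub ρ u)
    ρt∼ρu = Bisim⇒∼ (sound ρ)

    UsesNewSummand : Proc → Set
    UsesNewSummand r = (var x ∈ summands u × r ≡ Y) ⊎
      (∃₂ λ w₁ w₂ → F w₁ w₂ ∈ summands u × ∃ λ s₂ → r ≡ emb (sub ρ w₁) ∥ s₂ × Y ∈∥ s₂)

    -- Any other ᾱ-step would give σ(u) the trace ᾱ.α^M.
    long-ᾱ-step : ∀ {r} → Step f (emb (sub ρ u)) (nm (bar α)) r → Trace r (αs M) → UsesNewSummand r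
    long-ᾱ-step s tr = let (v , v∈ , s') = step-via-summand ρ u s in via v v∈ s' tr
      where
      via : ∀ v {r} → v ∈ summands u → Step f (emb (sub ρ v)) (nm (bar α)) r → Trace r (αs M) →
            UsesNewSummand r
      via (var y) v∈ s tr with y ≟ x
      via (var y) v∈ (sumL s) tr | yes refl = ⊥-elim (σu-too-long (step-from-summand σ u v∈ s ∷ tr))
      via (var y) v∈ (sumR pre) tr | yes refl = inj₁ (v∈ , refl)
      ... | no _ = ⊥-elim (σu-too-long (step-from-summand σ u v∈ s ∷ tr))
      via (w₁ ⊕ w₂) v∈ = ⊥-elim (summand-not-sum u v∈)
      via (μ · w) v∈ pre tr =
        ⊥-elim (σu-too-long (step-from-summand σ u v∈ pre ∷ ext-trace M (bar-≢ α) (ext w) tr))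
      via (F w₁ w₂) v∈ (fL h _) = ⊥-elim (true≢false h ¬Lᾱ)
      via (F w₁ w₂) v∈ (fR h s) tr with ext-back (ext w₂) s
      ... | inj₁ (_ , sσ , e) =
        ⊥-elim (σu-too-long (step-from-summand σ u v∈ (fR h sσ) ∷ ext-trace M (bar-≢ α) (ext w₁ ∥ e) tr))
      ... | inj₂ fresh = inj₂ (w₁ , w₂ , v∈ , _ , refl , Fresh.residual fresh)

    var-summand-preserved : var x ∈ summands t → var x ∈ summands u
    var-summand-preserved x∈ with ∼-forth ρt∼ρu (step-from-summand ρ t x∈ ρx-ᾱ)
    ... | r , s , Y∼r with long-ᾱ-step s (∼-trace Y∼r (pow-trace (nm α) M))
    ...   | inj₁ (x∈u , _) = x∈u
    ...   | inj₂ (w₁ , w₂ , F∈ , s₂ , refl , Y∈∥s₂) =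
      ⊥-elim (¬𝟎factor-u (zero-factor σ (summand⇒⊑ u F∈) (inj₁ σw₁∼𝟎)))
      where
      σw₁∼𝟎 : emb (sub σ w₁) ∼ 𝟎
      σw₁∼𝟎 = stuck⇒∼𝟎 λ s → let (_ , s' , _) = ext-forth (ext w₁) s in
        ∼Y-too-long (∼-sym Y∼r) (parL s' ∷ trace-∥ʳ (∈∥-trace Y∈∥s₂ (pow-trace (nm α) M)))

    module _ {t₁ t₂ : Tm ℕ} (F∈ : F t₁ t₂ ∈ summands t) (x∈ : var x ∈ summands t₂)
             (σt₁∼α : emb (sub σ t₁) ∼ nm α · 𝟎) (σx-ᾱ : Enabled (emb (σ x)) (nm (bar α))) where

      Z : Proc
      Z = emb (sub ρ t₁) ∥ Y

      σt₁-label : ∀ {μ} → Enabled (emb (sub σ t₁)) μ → μ ≡ nm α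
      σt₁-label (_ , s) = sym (prefix-step-label (proj₁ (proj₂ (∼-forth σt₁∼α s))))

      -- a fresh step of ρ(t₁) would be inherited by σ(t₁), since σ(x) can perform ᾱ
      Z-label : ∀ {μ z} → Step f Z μ z → μ ≡ nm α
      Z-label (parL s) with ext-back (ext t₁) s
      ... | inj₁ (_ , sσ , _) = σt₁-label (_ , sσ)
      ... | inj₂ fresh = σt₁-label (Fresh.inherited fresh σx-ᾱ)
      Z-label (parR s) = pow-step-label {m = M} s
      Z-label (parS s₁ s₂) with Z-label (parL s₁) | pow-step-label {m = M} s₂
      ... | refl | ᾱ≡α = ⊥-elim (bar-≢ α (sym ᾱ≡α))

      Z-trace : Trace Z (nm α ∷ αs M)
      Z-trace = let (_ , s , _) = ∼-back σt₁∼α pre ; (_ , s' , _) = ext-forth (ext t₁) s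
                in parL s' ∷ trace-∥ʳ (pow-trace (nm α) M)

      F-summand-with-var : SummandBisimilarToTarget (sub σ u)
      F-summand-with-var
        with ∼-forth ρt∼ρu (step-from-summand ρ t F∈ (fR Rᾱ (step-from-summand ρ t₂ x∈ ρx-ᾱ)))
      ... | r , s , Z∼r with long-ᾱ-step s (∼-trace Z∼r (trace-∥ʳ (pow-trace (nm α) M)))
      ...   | inj₁ (_ , refl) = ⊥-elim (∼Y-too-long Z∼r Z-trace)
      ...   | inj₂ (w₁ , w₂ , F∈u , s₂ , refl , _) = F-summand-match F∈u σw₁-α
        where
        σw₁≁𝟎 : ¬ emb (sub σ w₁) ∼ 𝟎
        σw₁≁𝟎 z = ¬𝟎factor-u (zero-factor σ (summand⇒⊑ u F∈u) (inj₁ z))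
        σw₁-α : Enabled (emb (sub σ w₁)) (nm α)
        σw₁-α with ≁𝟎⇒enabled σw₁≁𝟎
        ... | μ , _ , s with ext-forth (ext w₁) s
        ... | _ , s' , _ with Z-label (proj₁ (proj₂ (∼-back Z∼r (parL s'))))
        ... | refl = _ , s

  ReachesPL : ℕ → Tm ℕ → Set
  ReachesPL j v = ∃ λ r → Step f (emb (sub σ v)) (nm (bar α)) r × r ∼ PL j

  module _ {t₁ t₂ : Tm ℕ} (F∈ : F t₁ t₂ ∈ summands t) (σt₂∼pn : emb (sub σ t₂) ∼ PN n) where

    t₂⊑t : t₂ ⊑ t
    t₂⊑t = ⊑-trans (inFR here) (summand⇒⊑ t F∈)

    σt₂-label : ∀ {v μ r} → v ∈ summands t₂ → Step f (emb (sub σ v)) μ r → μ ≡ nm (bar α)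
    σt₂-label v∈ s = proj₁ (pn-step-inv n (proj₁ (proj₂ (∼-forth σt₂∼pn (step-from-summand σ t₂ v∈ s)))))

    var-summand≁𝟎 : ∀ {x} → var x ∈ summands t₂ → ¬ emb (σ x) ∼ 𝟎
    var-summand≁𝟎 x∈ σx∼𝟎 with summand-whole-or-operand t₂ x∈
    ... | inj₁ refl = ∼𝟎⇒stuck (∼-trans (∼-sym σt₂∼pn) σx∼𝟎) (pn-step z≤n)
    ... | inj₂ (_ , _ , l⊕r⊑t₂ , operand) = ¬𝟎summand-t (zero-summand σ (⊑-trans l⊕r⊑t₂ t₂⊑t)
            (Sum.map (λ { refl → σx∼𝟎 }) (λ { refl → σx∼𝟎 }) operand))

    var-summand-ᾱ : ∀ {x} → var x ∈ summands t₂ → Enabled (emb (σ x)) (nm (bar α))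
    var-summand-ᾱ x∈ with ≁𝟎⇒enabled (var-summand≁𝟎 x∈)
    ... | _ , _ , s with σt₂-label x∈ s
    ... | refl = _ , s

    F-summand-¬ReachesPL : ∀ {w₁ w₂ j} → F w₁ w₂ ∈ summands t₂ → ¬ ReachesPL j (F w₁ w₂)
    F-summand-¬ReachesPL F∈t₂ (_ , fL h _ , _) = true≢false h ¬Lᾱ
    F-summand-¬ReachesPL {w₁} {w₂} {j} F∈t₂ (_ , fR _ _ , b) =
      ¬𝟎factor-t (zero-factor σ (⊑-trans (summand⇒⊑ t₂ F∈t₂) t₂⊑t) (inj₁ (stuck⇒∼𝟎 stuck)))
      where
      -- a step of σ(w₁) is an α-step, hence lifts by L_α to an α-step of σ(t₂) ∼ p_n
      stuck : ∀ {μ s} → ¬ Step f (emb (sub σ w₁)) μ s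
      stuck s with powLe-step-label {j} (proj₁ (proj₂ (∼-forth b (parL s))))
      ... | refl = bar-≢ α (σt₂-label F∈t₂ (fL Lα s))

    ReachesPL-unique : (∀ {y} → var y ∉ summands t₂) →
      ∀ {v i j} → v ∈ summands t₂ → ReachesPL i v → ReachesPL j v → i ≡ j
    ReachesPL-unique no-var {var y} v∈ = ⊥-elim (no-var v∈)
    ReachesPL-unique no-var {v ⊕ w} v∈ = ⊥-elim (summand-not-sum t₂ v∈)
    ReachesPL-unique no-var {μ · w} {i} {j} v∈ (_ , pre , b) (_ , pre , b') =
      powLe-injective {i} {j} (∼-trans (∼-sym b) b')
    ReachesPL-unique no-var {F w₁ w₂} {i} v∈ r = ⊥-elim (F-summand-¬ReachesPL {j = i} v∈ r)

    -- p_n has n + 1 pairwise non-bisimilar ᾱ-derivatives, but t₂ has at most size t < n summands.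
    some-var-summand : ∃ λ x → var x ∈ summands t₂
    some-var-summand with var-summand? t₂
    ... | inj₁ x∈ = x∈
    ... | inj₂ no-var = ⊥-elim (1+n≰n (≤-trans enough-summands
            (≤-trans (length-summands≤1+size t₂) (≤-trans (s≤s (size-mono-⊑ t₂⊑t)) size-t<n))))
      where
      witness : ∀ i → ∃ λ v → v ∈ summands t₂ × ReachesPL (toℕ i) v
      witness i with ∼-back σt₂∼pn (pn-step (toℕ≤pred[n] i))
      ... | r , s , b = let (v , v∈ , s') = step-via-summand σ t₂ s in v , v∈ , r , s' , b
      enough-summands : suc n ≤ length (summands t₂)
      enough-summands = distinct-witnesses≤length (summands t₂) (λ i → ReachesPL (toℕ i)) witness
                          (λ v∈ r r' → toℕ-injective (ReachesPL-unique no-var v∈ r r'))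

  F-summand-preserved : ∀ {t₁ t₂} → F t₁ t₂ ∈ summands t → emb (sub σ (F t₁ t₂)) ∼ T →
    SummandBisimilarToTarget (sub σ u)
  F-summand-preserved {t₁} {t₂} F∈ b =
    let (σt₁∼α , σt₂∼pn) = target-components (∼-forth b) σt₂≁𝟎 σt₁-α
        (x , x∈) = some-var-summand F∈ σt₂∼pn
    in FreshSummandAt.F-summand-with-var x F∈ x∈ σt₁∼α (var-summand-ᾱ F∈ σt₂∼pn x∈)
    where
    σt₂≁𝟎 : ¬ emb (sub σ t₂) ∼ 𝟎
    σt₂≁𝟎 z = ¬𝟎factor-t (zero-factor σ (summand⇒⊑ t F∈) (inj₂ z))
    σt₁-α : Enabled (emb (sub σ t₁)) (nm α)
    σt₁-α with ∼-back b target-α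
    ... | _ , fL _ s , _ = _ , s
    ... | _ , fR h _ , _ = ⊥-elim (true≢false h ¬Rα)

  summand-preserved : SummandBisimilarToTarget (sub σ t) → SummandBisimilarToTarget (sub σ u)
  summand-preserved (s , s∈ , s∼T) with summand-sub-origin σ t s∈
  ... | inj₁ (x , x∈ , s∈σx) = s , summands-sub σ u (FreshSummandAt.var-summand-preserved x x∈) s∈σx , s∼T
  ... | inj₂ (_ , _ , refl , 𝟎) with ∼-back (Bisim⇒∼ s∼T) target-α
  ...   | _ , () , _
  summand-preserved (s , s∈ , s∼T) | inj₂ (_ , _ , refl , prefix)
    with ∼-back (Bisim⇒∼ s∼T) target-α | ∼-back (Bisim⇒∼ s∼T) target-ᾱ
  ... | _ , s₁ , _ | _ , s₂ , _ =
    ⊥-elim (bar-≢ α (trans (sym (prefix-step-label s₁)) (prefix-step-label s₂)))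
  summand-preserved (s , s∈ , s∼T) | inj₂ (_ , F∈ , refl , F) = F-summand-preserved F∈ (Bisim⇒∼ s∼T)

proposition11 : (f : FSpec) → Standing f → (α : Name) →
    L f (nm α) ≡ true → R f (nm α) ≡ false →
    R f (nm (bar α)) ≡ true → L f (nm (bar α)) ≡ false →
    S f α ≡ true →
    (t u : Tm ℕ) → Sound f t u → (σ : ℕ → CTm) →
    ¬ HasZeroSummand f (sub σ t) → ¬ HasZeroFactor f (sub σ t) →
    ¬ HasZeroSummand f (sub σ u) → ¬ HasZeroFactor f (sub σ u) →
    (n : ℕ) → size t < n →
    Bisim f (emb (sub σ t)) (emb (target α n)) →
    Bisim f (emb (sub σ u)) (emb (target α n)) →
    Σ CTm (λ s → (s ∈ summands (sub σ t)) × Bisim f (emb s) (emb (target α n))) →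
    Σ CTm (λ s → (s ∈ summands (sub σ u)) × Bisim f (emb s) (emb (target α n)))
proposition11 f _ α Lα ¬Rα Rᾱ ¬Lᾱ _ t u sound σ ¬𝟎summand-t ¬𝟎factor-t _ ¬𝟎factor-u
              n size-t<n _ σu∼T =
  SummandPreservation.summand-preserved f α Lα ¬Rα Rᾱ ¬Lᾱ t u sound σ ¬𝟎summand-t ¬𝟎factor-t ¬𝟎factor-u
    n size-t<n (Semantics.Bisim⇒∼ f σu∼T)
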